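{- Let $k\ge 2$ and $n_1\ge n_2\ge\dots\ge n_{k-1}\ge n_k=1$, and let $N=n_1+\dots+n_k$. Then for every $p\in\mathbb{N}$, the complete multipartite graph $K_{n_1,\dots,n_{k-1},1}$ (unweighted) satisfies $$\mathcal{C}_p(K_{n_1,\dots,n_{k-1},1})=\left(\sum_{i=1}^{k-1}n_i(N-n_i)^p\right)^{1/p},$$ attained by the radial spanning tree rooted at the unique vertex of the part of size $1$.
   Context: $K_{n_1,\dots,n_k}$ is the complete multipartite graph whose vertex set is partitioned into parts $X_1,\dots,X_k$ with $|X_i|=n_i$, two vertices being adjacent iff they lie in different parts. For an unweighted connected graph $G$, a spanning tree $T$ and $e\in E_T$, the congestion $\mathcal{C}(G,T,e)$ is the number of edges of $G$ with one endpoint in each of the two components of $T$ minus $e$; $\mathcal{C}_p(G,T)=\|(\mathcal{C}(G,T,e))_{e\in E_T}\|_p$ and $\mathcal{C}_p(G)=\min_T\mathcal{C}_p(G,T)$ over all spanning trees. A radial spanning tree rooted at $v$ consists of all edges from $v$ to the other vertices. -}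

module Defs where

open import Data.Nat using (ℕ; zero; suc; _+_; _*_; _∸_; _^_; _≤_)
open import Data.Fin as F using (Fin; _≟_; _<?_)
open import Data.Bool using (Bool; true; false; _∧_; _∨_; not; _xor_)
open import Data.List using (List; []; _∷_; map; concatMap; filterᵇ; allFin; length)
open import Data.Bool.ListAction using (any)
open import Data.Nat.ListAction using (sum)
open import Data.Product using (_×_; _,_; proj₁; proj₂)
open import Relation.Nullary.Decidable using (⌊_⌋)
open import Relation.Binary.PropositionalEquality using (_≡_)

Graph : ℕ → Set
Graph N = Fin N → Fin N → Bool

eqᵇ : ∀ {N} → Fin N → Fin N → Bool
eqᵇ x y = ⌊ x ≟ y ⌋

-- unordered pairs {x,y} of distinct vertices, represented as (x , y) with x < y
pairs : (N : ℕ) → List (Fin N × Fin N)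
pairs N = concatMap (λ x → map (x ,_) (filterᵇ (λ y → ⌊ x <? y ⌋) (allFin N))) (allFin N)

edges : ∀ {N} → Graph N → List (Fin N × Fin N)
edges {N} G = filterᵇ (λ e → G (proj₁ e) (proj₂ e)) (pairs N)

reachᵇ : ∀ {N} → Graph N → ℕ → Fin N → Fin N → Bool
reachᵇ G zero a x = eqᵇ a x
reachᵇ {N} G (suc k) a x = reachᵇ G k a x ∨ any (λ y → reachᵇ G k a y ∧ G y x) (allFin N)

-- x and y lie in the same connected component (walks of length ≤ N suffice)
Connectedᵇ : ∀ {N} → Graph N → Fin N → Fin N → Bool
Connectedᵇ {N} G = reachᵇ G N

removeEdge : ∀ {N} → Graph N → Fin N → Fin N → Graph N
removeEdge T a b x y = T x y ∧ not ((eqᵇ x a ∧ eqᵇ y b) ∨ (eqᵇ x b ∧ eqᵇ y a))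

IsSimple : ∀ {N} → Graph N → Set
IsSimple {N} G = (∀ x y → G x y ≡ G y x) × (∀ x → G x x ≡ false)

-- T is a spanning tree of G: a simple subgraph of G on all vertices that is
-- connected and acyclic (no edge of T lies on a cycle, i.e. its endpoints are
-- disconnected once the edge is removed).
IsSpanningTree : ∀ {N} → Graph N → Graph N → Set
IsSpanningTree {N} G T =
  IsSimple T
  × (∀ x y → T x y ≡ true → G x y ≡ true)
  × (∀ x y → Connectedᵇ T x y ≡ true)
  × (∀ a b → T a b ≡ true → Connectedᵇ (removeEdge T a b) a b ≡ false)

-- congestion C(G,T,e) of the tree edge e = {a,b}: number of edges of G joining
-- the two components of T - e (the component of a versus the rest).
congestion : ∀ {N} → Graph N → Graph N → Fin N → Fin N → ℕ
congestion G T a b =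
  length (filterᵇ (λ e → G (proj₁ e) (proj₂ e) ∧ (S (proj₁ e) xor S (proj₂ e))) (pairs _))
  where S = Connectedᵇ (removeEdge T a b) a

-- p-th power of the p-norm: C_p(G,T)^p = Σ_{e ∈ E_T} C(G,T,e)^p
congestionPow : ∀ {N} → Graph N → Graph N → ℕ → ℕ
congestionPow G T p = sum (map (λ e → congestion G T (proj₁ e) (proj₂ e) ^ p) (edges T))

multipartite : ∀ {N k} → (Fin N → Fin k) → Graph N
multipartite part x y = not ⌊ part x ≟ part y ⌋

partSize : ∀ {N k} → (Fin N → Fin k) → Fin k → ℕ
partSize {N} part i = length (filterᵇ (λ x → ⌊ part x ≟ i ⌋) (allFin N))

radial : ∀ {N} → Fin N → Graph N
radial r x y = (eqᵇ x r ∧ not (eqᵇ y r)) ∨ (eqᵇ y r ∧ not (eqᵇ x r))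

-- The vertex r forming the part of size 1 is adjacent to every other vertex.
-- Root a spanning tree T at r and give each x ≠ r the tree edge to its parent,
-- a neighbour one step closer to r; distinct vertices get distinct edges.
-- Deleting the parent edge of x separates x from r, and then every neighbour w
-- of x yields its own crossing edge of G: xw if w lies across the cut, wr if w
-- lies on the side of x.  So that edge has congestion at least deg x, whence
-- Σₑ C(e)ᵖ ≥ Σ_{x≠r} (deg x)ᵖ.  In the radial tree the spoke xr cuts off {x}
-- alone, so its congestion is exactly deg x and the bound is attained; finally
-- deg x = N − nᵢ for x in part i, while r contributes nothing.

module Submission where

open import Algebra.Properties.CommutativeSemigroup using (interchange)
open import Data.Bool using (Bool; true; false; _∧_; _∨_; not; _xor_; if_then_else_)
open import Data.Bool.ListAction using (any; or)
open import Data.Bool.Properties as Bool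
  using (T-≡; ∧-conicalˡ; ∧-conicalʳ; ∧-zeroʳ; ∨-zeroʳ; ∨-comm; ∧-comm; xor-comm; xor-same; xor-inverseˡ; ¬-not; not-¬)
open import Data.Fin as F using (Fin; fromℕ; inject₁)
import Data.Fin.Properties as Fin
open import Data.List using (List; []; _∷_; [_]; _++_; map; allFin; length; filterᵇ; tabulate)
open import Data.List.Membership.Propositional using (_∈_)
open import Data.List.Membership.Propositional.Properties
  using (∈-filter⁺; ∈-filter⁻; ∈-∃++; ∈-allFin; ∈-map⁺; ∈-map⁻; ∈-concatMap⁺; ∈-concatMap⁻)
open import Data.List.Properties
  using (map-cong; map-cong-local; map-tabulate; length-filter; length-tabulate; filter-some)
open import Data.List.Relation.Binary.Permutation.Propositional using (↭-sym)
open import Data.List.Relation.Binary.Permutation.Propositional.Properties using (shift; ∈-resp-↭; map⁺)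
open import Data.List.Relation.Unary.All as All using (All)
import Data.List.Relation.Unary.All.Properties as All
open import Data.List.Relation.Unary.AllPairs using (_∷_)
import Data.List.Relation.Unary.AllPairs as AllPairs
import Data.List.Relation.Unary.AllPairs.Properties as AllPairs
open import Data.List.Relation.Unary.Any as Any using (here; there)
open import Data.List.Relation.Unary.Any.Properties using (any⁺; any⁻)
open import Data.List.Relation.Unary.Unique.Propositional using (Unique)
import Data.List.Relation.Unary.Unique.Propositional.Properties as Unique
open import Data.Nat using (ℕ; zero; suc; _+_; _*_; _∸_; _^_; _≤_; _<_; z≤n; s≤s)
open import Data.Nat.ListAction using (sum)
open import Data.Nat.ListAction.Properties using (sum-↭)
open import Data.Nat.Properties
open import Data.Product using (_×_; _,_; proj₁; proj₂; ∃-syntax)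
import Data.Product as Product
open import Data.Product.Properties using (,-injective; ,-injectiveʳ)
open import Data.Sum using (_⊎_; inj₁; inj₂; [_,_]′)
import Data.Sum as Sum
open import Defs
open import Function using (_∘_; id)
open import Function.Bundles using (Equivalence)
open import Relation.Binary.Definitions using (tri<; tri≈; tri>)
open import Relation.Binary.PropositionalEquality hiding ([_])
open import Relation.Nullary using (¬_; yes; no; contradiction)
open import Relation.Nullary.Decidable using (⌊_⌋; T?; toSum)

newly-true : ∀ {b c : Bool} → (b ≡ true → c ≡ true) → c ≢ b → b ≡ false × c ≡ true
newly-true {true} b⇒c c≢b = contradiction (b⇒c refl) c≢b
newly-true {false} {true} _ _ = refl , refl
newly-true {false} {false} _ c≢b = contradiction refl c≢b

xor≡false⇒≡ : ∀ {a b} → a xor b ≡ false → a ≡ b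
xor≡false⇒≡ {false} {false} _ = refl
xor≡false⇒≡ {true} {true} _ = refl

eqᵇ-refl : ∀ {N} (x : Fin N) → eqᵇ x x ≡ true
eqᵇ-refl x with x F.≟ x
... | yes _ = refl
... | no x≢x = contradiction refl x≢x

eqᵇ-≢ : ∀ {N} {x y : Fin N} → x ≢ y → eqᵇ x y ≡ false
eqᵇ-≢ {x = x} {y} x≢y with x F.≟ y
... | yes x≡y = contradiction x≡y x≢y
... | no _ = refl

eqᵇ-sound : ∀ {N} {x y : Fin N} → eqᵇ x y ≡ true → x ≡ y
eqᵇ-sound {x = x} {y} h with x F.≟ y
... | yes x≡y = x≡y

eqᵇ-sym : ∀ {K} (i j : Fin K) → eqᵇ i j ≡ eqᵇ j i
eqᵇ-sym i j with i F.≟ j | j F.≟ i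
... | yes _ | yes _ = refl
... | no _ | no _ = refl
... | yes i≡j | no j≢i = contradiction (sym i≡j) j≢i
... | no i≢j | yes j≡i = contradiction (sym j≡i) i≢j

<ᵇ-complete : ∀ {N} {x y : Fin N} → x F.< y → ⌊ x F.<? y ⌋ ≡ true
<ᵇ-complete {x = x} {y} x<y with x F.<? y
... | yes _ = refl
... | no x≮y = contradiction x<y x≮y

module _ {A : Set} {p : A → Bool} where

  ∈-filterᵇ⁺ : ∀ {xs x} → x ∈ xs → p x ≡ true → x ∈ filterᵇ p xs
  ∈-filterᵇ⁺ x∈xs px = ∈-filter⁺ (T? ∘ p) x∈xs (Equivalence.from T-≡ px)

  ∈-filterᵇ⁻ : ∀ xs {x} → x ∈ filterᵇ p xs → x ∈ xs × p x ≡ true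
  ∈-filterᵇ⁻ xs x∈ = Product.map₂ (Equivalence.to T-≡) (∈-filter⁻ (T? ∘ p) x∈)

  Unique-filterᵇ : ∀ {xs} → Unique xs → Unique (filterᵇ p xs)
  Unique-filterᵇ = Unique.filter⁺ (T? ∘ p)

  any-true⁺ : ∀ {xs x} → x ∈ xs → p x ≡ true → any p xs ≡ true
  any-true⁺ x∈xs px = Equivalence.to T-≡ (any⁺ p (Any.map (λ { refl → Equivalence.from T-≡ px }) x∈xs))

  any-true⁻ : ∀ xs → any p xs ≡ true → ∃[ x ] p x ≡ true
  any-true⁻ xs h = Product.map₂ (Equivalence.to T-≡) (Any.satisfied (any⁻ p xs (Equivalence.from T-≡ h)))

module _ {A B : Set} (f : A → B) where

  sum-≤-injection : ∀ (g : A → ℕ) (w : B → ℕ) {xs ys} → Unique xs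
    → (∀ {a b} → a ∈ xs → b ∈ xs → f a ≡ f b → a ≡ b)
    → (∀ {a} → a ∈ xs → f a ∈ ys)
    → (∀ {a} → a ∈ xs → g a ≤ w (f a))
    → sum (map g xs) ≤ sum (map w ys)
  sum-≤-injection g w {[]} _ _ _ _ = z≤n
  sum-≤-injection g w {x ∷ xs} (x∉xs ∷ unique) inj into bound
    with as , bs , refl ← ∈-∃++ (into (here refl)) = begin
      g x + sum (map g xs)              ≤⟨ +-monoʳ-≤ (g x) rest ⟩
      g x + sum (map w (as ++ bs))      ≤⟨ +-monoˡ-≤ _ (bound (here refl)) ⟩
      sum (map w (f x ∷ as ++ bs))      ≡⟨ sum-↭ (map⁺ w (↭-sym (shift (f x) as bs))) ⟩
      sum (map w (as ++ [ f x ] ++ bs)) ∎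
    where
    open ≤-Reasoning
    into′ : ∀ {a} → a ∈ xs → f a ∈ as ++ bs
    into′ {a} a∈xs with ∈-resp-↭ (shift (f x) as bs) (into (there a∈xs))
    ... | here fa≡fx = contradiction (inj (here refl) (there a∈xs) (sym fa≡fx)) (All.lookup x∉xs a∈xs)
    ... | there fa∈ = fa∈
    rest = sum-≤-injection g w unique (λ a∈ b∈ → inj (there a∈) (there b∈)) into′ (bound ∘ there)

sum-map-const : ∀ {A : Set} c (xs : List A) → sum (map (λ _ → c) xs) ≡ length xs * c
sum-map-const c [] = refl
sum-map-const c (x ∷ xs) = cong (c +_) (sum-map-const c xs)

length-≤-injection : ∀ {A B : Set} (f : A → B) {xs ys} → Unique xs
  → (∀ {a b} → a ∈ xs → b ∈ xs → f a ≡ f b → a ≡ b)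
  → (∀ {a} → a ∈ xs → f a ∈ ys)
  → length xs ≤ length ys
length-≤-injection f {xs} {ys} unique inj into =
  subst₂ _≤_ (trans (sum-map-const 1 xs) (*-identityʳ _)) (trans (sum-map-const 1 ys) (*-identityʳ _))
    (sum-≤-injection f (λ _ → 1) (λ _ → 1) unique inj into (λ _ → ≤-refl))

module _ {A : Set} where

  sum-map-filterᵇ : ∀ (P : A → Bool) (f : A → ℕ) xs
    → sum (map f (filterᵇ P xs)) ≡ sum (map (λ x → if P x then f x else 0) xs)
  sum-map-filterᵇ P f [] = refl
  sum-map-filterᵇ P f (x ∷ xs) with P x
  ... | true = cong (f x +_) (sum-map-filterᵇ P f xs)
  ... | false = sum-map-filterᵇ P f xs

  length-filterᵇ-complement : ∀ (P : A → Bool) xs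
    → length (filterᵇ P xs) + length (filterᵇ (not ∘ P) xs) ≡ length xs
  length-filterᵇ-complement P [] = refl
  length-filterᵇ-complement P (x ∷ xs) with P x
  ... | true = cong suc (length-filterᵇ-complement P xs)
  ... | false = trans (+-suc _ _) (cong suc (length-filterᵇ-complement P xs))

  sum-map-+ : ∀ (f g : A → ℕ) xs → sum (map (λ x → f x + g x) xs) ≡ sum (map f xs) + sum (map g xs)
  sum-map-+ f g [] = refl
  sum-map-+ f g (x ∷ xs) =
    trans (cong (f x + g x +_) (sum-map-+ f g xs)) (interchange +-commutativeSemigroup (f x) (g x) _ _)

  sum-map-zero : ∀ {f : A → ℕ} {xs} → All (λ x → f x ≡ 0) xs → sum (map f xs) ≡ 0
  sum-map-zero {xs = xs} zeros =
    trans (cong sum (map-cong-local zeros)) (trans (sum-map-const 0 xs) (*-zeroʳ (length xs)))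

sum-map-swap : ∀ {A B : Set} (f : A → B → ℕ) xs ys
  → sum (map (λ x → sum (map (f x) ys)) xs) ≡ sum (map (λ y → sum (map (λ x → f x y) xs)) ys)
sum-map-swap f [] ys = sym (sum-map-zero {xs = ys} (All.tabulate (λ _ → refl)))
sum-map-swap f (x ∷ xs) ys =
  trans (cong (sum (map (f x) ys) +_) (sum-map-swap f xs ys)) (sym (sum-map-+ (f x) _ ys))

minimal : ∀ (P : ℕ → Bool) k → P k ≡ true → ∃[ d ] P d ≡ true × (∀ {j} → P j ≡ true → d ≤ j)
minimal P k Pk with P 0 in P0
... | true = 0 , P0 , λ _ → z≤n
minimal P zero Pk | false = contradiction (trans (sym Pk) P0) λ ()
minimal P (suc k) Pk | false with d , Pd , least ← minimal (P ∘ suc) k Pk =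
  suc d , Pd , λ { {zero} P0′ → contradiction (trans (sym P0′) P0) λ () ; {suc j} Pj → s≤s (least Pj) }

sum-indicator : ∀ {K} (j : Fin K) (c : Fin K → ℕ) {xs} → Unique xs → j ∈ xs
  → sum (map (λ i → if eqᵇ j i then c i else 0) xs) ≡ c j
sum-indicator j c (j∉xs ∷ _) (here refl) rewrite eqᵇ-refl j =
  trans (cong (c j +_) (sum-map-zero (All.map (λ j≢i → cong (if_then c _ else 0) (eqᵇ-≢ j≢i)) j∉xs)))
        (+-identityʳ (c j))
sum-indicator j c {x ∷ _} (x∉xs ∷ unique) (there j∈xs) with j F.≟ x
... | yes refl = contradiction refl (All.lookup x∉xs j∈xs)
... | no _ = sum-indicator j c unique j∈xs

sum-allFin-last : ∀ m (f : Fin (suc m) → ℕ)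
  → sum (map f (allFin (suc m))) ≡ sum (map (f ∘ inject₁) (allFin m)) + f (fromℕ m)
sum-allFin-last m f = begin
  sum (map f (allFin (suc m)))                     ≡⟨ cong sum (map-tabulate id f) ⟩
  sum (tabulate f)                                 ≡⟨ sum-tabulate-last m f ⟩
  sum (tabulate (f ∘ inject₁)) + f (fromℕ m)       ≡⟨ cong (λ l → sum l + f (fromℕ m)) (map-tabulate id (f ∘ inject₁)) ⟨
  sum (map (f ∘ inject₁) (allFin m)) + f (fromℕ m) ∎
  where
  open ≡-Reasoning
  sum-tabulate-last : ∀ m (f : Fin (suc m) → ℕ) → sum (tabulate f) ≡ sum (tabulate (f ∘ inject₁)) + f (fromℕ m)
  sum-tabulate-last zero f = +-comm (f F.zero) 0
  sum-tabulate-last (suc m) f =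
    trans (cong (f F.zero +_) (sum-tabulate-last m (f ∘ F.suc))) (sym (+-assoc (f F.zero) _ _))

-- The representative of {x , y} in `pairs`.
sortedPair : ∀ {N} → Fin N → Fin N → Fin N × Fin N
sortedPair x y with x F.<? y
... | yes _ = x , y
... | no _ = y , x

sortedPair-cases : ∀ {N} (x y : Fin N) → sortedPair x y ≡ (x , y) ⊎ sortedPair x y ≡ (y , x)
sortedPair-cases x y with x F.<? y
... | yes _ = inj₁ refl
... | no _ = inj₂ refl

sortedPair-< : ∀ {N} {x y : Fin N} → x F.< y → sortedPair x y ≡ (x , y)
sortedPair-< {x = x} {y} x<y with x F.<? y
... | yes _ = refl
... | no x≮y = contradiction x<y x≮y

sortedPair-> : ∀ {N} {x y : Fin N} → y F.< x → sortedPair x y ≡ (y , x)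
sortedPair-> {x = x} {y} y<x with x F.<? y
... | yes x<y = contradiction x<y (Fin.<-asym y<x)
... | no _ = refl

sortedPair-≡ : ∀ {N} {x y x′ y′ : Fin N} → sortedPair x y ≡ sortedPair x′ y′
  → (x ≡ x′ × y ≡ y′) ⊎ (x ≡ y′ × y ≡ x′)
sortedPair-≡ {x = x} {y} {x′} {y′} eq with sortedPair-cases x y | sortedPair-cases x′ y′
... | inj₁ p | inj₁ q = inj₁ (,-injective (trans (sym p) (trans eq q)))
... | inj₁ p | inj₂ q = inj₂ (,-injective (trans (sym p) (trans eq q)))
... | inj₂ p | inj₁ q = inj₂ (Product.swap (,-injective (trans (sym p) (trans eq q))))
... | inj₂ p | inj₂ q = inj₁ (Product.swap (,-injective (trans (sym p) (trans eq q))))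

sortedPair-injectiveˡ : ∀ {N} {x x′ y : Fin N} → sortedPair x y ≡ sortedPair x′ y → x ≡ x′
sortedPair-injectiveˡ eq = [ proj₁ , (λ (x≡y , y≡x′) → trans x≡y y≡x′) ]′ (sortedPair-≡ eq)

sortedPair-injectiveʳ : ∀ {N} {x y y′ : Fin N} → sortedPair x y ≡ sortedPair x y′ → y ≡ y′
sortedPair-injectiveʳ eq = [ proj₂ , (λ (x≡y′ , y≡x) → trans y≡x x≡y′) ]′ (sortedPair-≡ eq)

sortedPair-holds : ∀ {N} (Q : Fin N → Fin N → Bool) → (∀ x y → Q x y ≡ Q y x)
  → ∀ {x y} → Q x y ≡ true → Q (proj₁ (sortedPair x y)) (proj₂ (sortedPair x y)) ≡ true
sortedPair-holds Q Q-sym {x} {y} Qxy with sortedPair-cases x y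
... | inj₁ eq rewrite eq = Qxy
... | inj₂ eq rewrite eq = trans (Q-sym y x) Qxy

∈-pairs : ∀ {N} {x y : Fin N} → x F.< y → (x , y) ∈ pairs N
∈-pairs {N} {x} {y} x<y = ∈-concatMap⁺ _ (Any.map (λ { refl → ∈-row }) (∈-allFin x))
  where ∈-row = ∈-map⁺ (x ,_) (∈-filterᵇ⁺ (∈-allFin y) (<ᵇ-complete x<y))

∈-pairs⁻ : ∀ {N} {e : Fin N × Fin N} → e ∈ pairs N → proj₁ e F.< proj₂ e
∈-pairs⁻ {N} e∈
  with x , e∈x ← Any.satisfied (∈-concatMap⁻ _ {xs = allFin N} e∈)
  with y , y∈ , refl ← ∈-map⁻ (x ,_) e∈x
  with x F.<? y | proj₂ (∈-filterᵇ⁻ (allFin N) y∈)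
... | yes x<y | _ = x<y

sortedPair-∈-pairs : ∀ {N} {x y : Fin N} → x ≢ y → sortedPair x y ∈ pairs N
sortedPair-∈-pairs {x = x} {y} x≢y with Fin.<-cmp x y
... | tri< x<y _ _ = subst (_∈ pairs _) (sym (sortedPair-< x<y)) (∈-pairs x<y)
... | tri≈ _ x≡y _ = contradiction x≡y x≢y
... | tri> _ _ y<x = subst (_∈ pairs _) (sym (sortedPair-> y<x)) (∈-pairs y<x)

Unique-pairs : ∀ N → Unique (pairs N)
Unique-pairs N = Unique.concat⁺
  (All.map⁺ (All.tabulate (λ _ → Unique.map⁺ ,-injectiveʳ (Unique-filterᵇ (Unique.allFin⁺ N)))))
  (AllPairs.map⁺ (AllPairs.map disjoint (Unique.allFin⁺ N)))
  where
  disjoint : ∀ {x x′} → x ≢ x′ → ∀ {e} → ¬ (e ∈ map (x ,_) _ × e ∈ map (x′ ,_) _)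
  disjoint {x} {x′} x≢x′ (e∈ , e∈′)
    with _ , _ , refl ← ∈-map⁻ (x ,_) e∈ | _ , _ , refl ← ∈-map⁻ (x′ ,_) e∈′ = x≢x′ refl

other : ∀ {N} → Fin N → Fin N × Fin N → Fin N
other x (u , v) = if eqᵇ u x then v else u

sortedPair-other : ∀ {N} {x : Fin N} {e} → proj₁ e F.< proj₂ e → proj₁ e ≡ x ⊎ proj₂ e ≡ x
  → sortedPair x (other x e) ≡ e
sortedPair-other {e = u , v} u<v (inj₁ refl) rewrite eqᵇ-refl u = sortedPair-< u<v
sortedPair-other {e = u , v} u<v (inj₂ refl) rewrite eqᵇ-≢ (Fin.<⇒≢ u<v) = sortedPair-> u<v

∈-edges⁻ : ∀ {N} {T : Graph N} {e} → e ∈ edges T → proj₁ e F.< proj₂ e × T (proj₁ e) (proj₂ e) ≡ true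
∈-edges⁻ {N} e∈ = Product.map₁ ∈-pairs⁻ (∈-filterᵇ⁻ (pairs N) e∈)

sortedPair-∈-edges : ∀ {N} {T : Graph N} → (∀ x y → T x y ≡ T y x)
  → ∀ {x y} → x ≢ y → T x y ≡ true → sortedPair x y ∈ edges T
sortedPair-∈-edges {T = T} T-sym x≢y Txy =
  ∈-filterᵇ⁺ (sortedPair-∈-pairs x≢y) (sortedPair-holds T T-sym Txy)

-- Walks and connectivity

module Walks {N} (G : Graph N) where

  reach-suc : ∀ k {a x} → reachᵇ G k a x ≡ true → reachᵇ G (suc k) a x ≡ true
  reach-suc k h rewrite h = refl

  reach-mono : ∀ {k l a x} → k ≤ l → reachᵇ G k a x ≡ true → reachᵇ G l a x ≡ true
  reach-mono {k} {l} k≤l h with o , refl ← m≤n⇒∃[o]m+o≡n k≤l = go o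
    where
    go : ∀ o → reachᵇ G (k + o) _ _ ≡ true
    go zero rewrite +-identityʳ k = h
    go (suc o) rewrite +-suc k o = reach-suc (k + o) (go o)

  reach-refl : ∀ k a → reachᵇ G k a a ≡ true
  reach-refl k a = reach-mono {0} {k} z≤n (eqᵇ-refl a)

  reach-step : ∀ k {a y x} → reachᵇ G k a y ≡ true → G y x ≡ true → reachᵇ G (suc k) a x ≡ true
  reach-step k {a} {y} {x} h Gyx =
    trans (cong (reachᵇ G k a x ∨_) (any-true⁺ (∈-allFin y) (cong₂ _∧_ h Gyx))) (∨-zeroʳ _)

  reach-last-step : ∀ k {a x} → reachᵇ G (suc k) a x ≡ true
    → reachᵇ G k a x ≡ true ⊎ ∃[ y ] reachᵇ G k a y ≡ true × G y x ≡ true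
  reach-last-step k {a} {x} h with reachᵇ G k a x
  ... | true = inj₁ refl
  ... | false with y , h′ ← any-true⁻ (allFin N) h = inj₂ (y , ∧-conicalˡ _ _ h′ , ∧-conicalʳ _ _ h′)

  reach-++ : ∀ k l {a b c}
    → reachᵇ G k a b ≡ true → reachᵇ G l b c ≡ true → reachᵇ G (k + l) a c ≡ true
  reach-++ k zero h₁ h₂ with refl ← eqᵇ-sound h₂ rewrite +-identityʳ k = h₁
  reach-++ k (suc l) h₁ h₂ rewrite +-suc k l with reach-last-step l h₂
  ... | inj₁ h = reach-suc (k + l) (reach-++ k l h₁ h)
  ... | inj₂ (y , h , Gyc) = reach-step (k + l) (reach-++ k l h₁ h) Gyc

  reach-sym : (∀ x y → G x y ≡ G y x) → ∀ k {a b} → reachᵇ G k a b ≡ true → reachᵇ G k b a ≡ true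
  reach-sym G-sym zero h with refl ← eqᵇ-sound h = h
  reach-sym G-sym (suc k) {a} {b} h with reach-last-step k h
  ... | inj₁ h′ = reach-suc k (reach-sym G-sym k h′)
  ... | inj₂ (y , h′ , Gyb) =
    reach-++ 1 k (reach-step 0 (eqᵇ-refl b) (trans (G-sym b y) Gyb)) (reach-sym G-sym k h′)

  reach-isolated : ∀ {x} → (∀ z → G z x ≡ false) → ∀ k {a} → reachᵇ G k a x ≡ true → a ≡ x
  reach-isolated isolated zero h = eqᵇ-sound h
  reach-isolated isolated (suc k) h with reach-last-step k h
  ... | inj₁ h′ = reach-isolated isolated k h′
  ... | inj₂ (y , _ , Gyx) = contradiction (trans (sym (isolated y)) Gyx) λ ()

  -- The vertices reachable from a within k steps form a list that grows
  -- strictly until it is stable, so it is stable from step N on.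
  module Saturation (a : Fin N) where

    Stable : ℕ → Set
    Stable k = ∀ x → reachᵇ G (suc k) a x ≡ reachᵇ G k a x

    stable-suc : ∀ {k} → Stable k → Stable (suc k)
    stable-suc stable x =
      cong₂ _∨_ (stable x) (cong or (map-cong (λ y → cong (_∧ G y x) (stable y)) (allFin N)))

    stable-+ : ∀ {j} → Stable j → ∀ t x → reachᵇ G (t + j) a x ≡ reachᵇ G j a x
    stable-+ stable zero x = refl
    stable-+ {j} stable (suc t) x = trans (stable-after t x) (stable-+ stable t x)
      where
      stable-after : ∀ t → Stable (t + j)
      stable-after zero = stable
      stable-after (suc t) = stable-suc {t + j} (stable-after t)

    reachable : ℕ → List (Fin N)
    reachable k = filterᵇ (reachᵇ G k a) (allFin N)

    length-reachable-≤ : ∀ k → length (reachable k) ≤ N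
    length-reachable-≤ k =
      ≤-trans (length-filter (T? ∘ reachᵇ G k a) (allFin N)) (≤-reflexive (length-tabulate id))

    reachable-grows : ∀ k → ¬ Stable k → length (reachable k) < length (reachable (suc k))
    reachable-grows k unstable
      with x , changed ← Fin.¬∀⟶∃¬ N _ (λ x → reachᵇ G (suc k) a x Bool.≟ reachᵇ G k a x) unstable
      with old , new ← newly-true (reach-suc k) changed =
      length-≤-injection id (fresh ∷ Unique-filterᵇ (Unique.allFin⁺ N)) (λ _ _ → id) into
      where
      fresh : All (x ≢_) (reachable k)
      fresh = All.tabulate λ y∈ x≡y →
        contradiction (trans (sym old) (subst _ (sym x≡y) (proj₂ (∈-filterᵇ⁻ (allFin N) y∈)))) λ ()
      into : ∀ {y} → y ∈ x ∷ reachable k → y ∈ reachable (suc k)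
      into (here refl) = ∈-filterᵇ⁺ (∈-allFin x) new
      into (there y∈) = ∈-filterᵇ⁺ (∈-allFin _) (reach-suc k (proj₂ (∈-filterᵇ⁻ (allFin N) y∈)))

    stabilises : ∀ k → (∃[ j ] j ≤ k × Stable j) ⊎ k < length (reachable k)
    stabilises zero =
      inj₂ (filter-some (T? ∘ reachᵇ G 0 a)
             (Any.map (λ { refl → Equivalence.from T-≡ (eqᵇ-refl a) }) (∈-allFin a)))
    stabilises (suc k) with stabilises k
    ... | inj₁ (j , j≤k , stable) = inj₁ (j , m≤n⇒m≤1+n j≤k , stable)
    ... | inj₂ k<length with Fin.all? (λ x → reachᵇ G (suc k) a x Bool.≟ reachᵇ G k a x)
    ...   | yes stable = inj₁ (k , n≤1+n k , stable)
    ...   | no unstable = inj₂ (≤-trans (s≤s k<length) (reachable-grows k unstable))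

    saturated : ∀ k {x} → reachᵇ G k a x ≡ true → Connectedᵇ G a x ≡ true
    saturated k {x} h with stabilises N
    ... | inj₂ N<length = contradiction (length-reachable-≤ N) (<⇒≱ N<length)
    ... | inj₁ (j , j≤N , stable) =
      reach-mono j≤N (trans (sym (stable-+ stable k x)) (reach-mono (m≤m+n k j) h))

  reach⇒connected : ∀ k {a b} → reachᵇ G k a b ≡ true → Connectedᵇ G a b ≡ true
  reach⇒connected k {a} = Saturation.saturated a k

  connected-refl : ∀ a → Connectedᵇ G a a ≡ true
  connected-refl = reach-refl N

  connected-edge : ∀ {a b} → G a b ≡ true → Connectedᵇ G a b ≡ true
  connected-edge {a} Gab = reach⇒connected 1 (reach-step 0 (eqᵇ-refl a) Gab)

  connected-trans : ∀ {a b c}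
    → Connectedᵇ G a b ≡ true → Connectedᵇ G b c ≡ true → Connectedᵇ G a c ≡ true
  connected-trans ab bc = reach⇒connected (N + N) (reach-++ N N ab bc)

  module _ (G-sym : ∀ x y → G x y ≡ G y x) where

    connected-sym : ∀ {a b} → Connectedᵇ G a b ≡ true → Connectedᵇ G b a ≡ true
    connected-sym = reach-sym G-sym N

    connected-respects : ∀ {a b c} → Connectedᵇ G b c ≡ true → Connectedᵇ G a b ≡ Connectedᵇ G a c
    connected-respects {a} {b} {c} bc with Connectedᵇ G a b in ab | Connectedᵇ G a c in ac
    ... | true | true = refl
    ... | false | false = refl
    ... | true | false = contradiction (trans (sym (connected-trans ab bc)) ac) λ ()
    ... | false | true = contradiction (trans (sym (connected-trans ac (connected-sym bc))) ab) λ ()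

removeEdge-sym : ∀ {N} {T : Graph N} → (∀ x y → T x y ≡ T y x)
  → ∀ a b x y → removeEdge T a b x y ≡ removeEdge T a b y x
removeEdge-sym T-sym a b x y = cong₂ _∧_ (T-sym x y) (cong not (begin
  (eqᵇ x a ∧ eqᵇ y b) ∨ (eqᵇ x b ∧ eqᵇ y a) ≡⟨ ∨-comm (eqᵇ x a ∧ eqᵇ y b) _ ⟩
  (eqᵇ x b ∧ eqᵇ y a) ∨ (eqᵇ x a ∧ eqᵇ y b) ≡⟨ cong₂ _∨_ (∧-comm (eqᵇ x b) _) (∧-comm (eqᵇ x a) _) ⟩
  (eqᵇ y a ∧ eqᵇ x b) ∨ (eqᵇ y b ∧ eqᵇ x a) ∎))
  where open ≡-Reasoning

removeEdge-removes : ∀ {N} (T : Graph N) a b → removeEdge T a b a b ≡ false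
removeEdge-removes T a b rewrite eqᵇ-refl a | eqᵇ-refl b = ∧-zeroʳ (T a b)

removeEdge-removes-reversed : ∀ {N} (T : Graph N) a b → removeEdge T a b b a ≡ false
removeEdge-removes-reversed T a b
  rewrite eqᵇ-refl a | eqᵇ-refl b | ∨-zeroʳ (eqᵇ b a ∧ eqᵇ a b) = ∧-zeroʳ (T b a)

removeEdge-keeps : ∀ {N} (T : Graph N) {a b x u v} → a ≡ x ⊎ b ≡ x → u ≢ x → v ≢ x
  → T u v ≡ true → removeEdge T a b u v ≡ true
removeEdge-keeps T {b = b} {u = u} (inj₁ refl) u≢a v≢a Tuv
  rewrite Tuv | eqᵇ-≢ u≢a | eqᵇ-≢ v≢a | ∧-zeroʳ (eqᵇ u b) = refl
removeEdge-keeps T {a = a} {u = u} (inj₂ refl) u≢b v≢b Tuv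
  rewrite Tuv | eqᵇ-≢ u≢b | eqᵇ-≢ v≢b | ∧-zeroʳ (eqᵇ u a) = refl

-- Cuts

neighbours : ∀ {N} → Graph N → Fin N → List (Fin N)
neighbours {N} G x = filterᵇ (λ w → G w x) (allFin N)

degree : ∀ {N} → Graph N → Fin N → ℕ
degree G x = length (neighbours G x)

crossing : ∀ {N} → Graph N → (Fin N → Bool) → Fin N × Fin N → Bool
crossing G S e = G (proj₁ e) (proj₂ e) ∧ (S (proj₁ e) xor S (proj₂ e))

cut : ∀ {N} → Graph N → (Fin N → Bool) → List (Fin N × Fin N)
cut {N} G S = filterᵇ (crossing G S) (pairs N)

cutSize : ∀ {N} → Graph N → (Fin N → Bool) → ℕ
cutSize G S = length (cut G S)

-- `congestion G T a b` unfolds to `cutSize G (side T a b)`.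
side : ∀ {N} → Graph N → Fin N → Fin N → Fin N → Bool
side T a b = Connectedᵇ (removeEdge T a b) a

module Cuts {N} {G : Graph N} (G-sym : ∀ x y → G x y ≡ G y x) where

  crossing-sym : ∀ S u v → crossing G S (u , v) ≡ crossing G S (v , u)
  crossing-sym S u v = cong₂ _∧_ (G-sym u v) (xor-comm (S u) (S v))

  sortedPair-∈-cut : ∀ S {u v} → u ≢ v → crossing G S (u , v) ≡ true → sortedPair u v ∈ cut G S
  sortedPair-∈-cut S u≢v crosses =
    ∈-filterᵇ⁺ (sortedPair-∈-pairs u≢v) (sortedPair-holds (λ u v → crossing G S (u , v)) (crossing-sym S) crosses)

  cutSize-≤-degree : ∀ S x → (∀ u v → u ≢ x → v ≢ x → S u ≡ S v) → cutSize G S ≤ degree G x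
  cutSize-≤-degree S x constant =
    length-≤-injection (other x) (Unique-filterᵇ (Unique-pairs N)) injective into
    where
    touches : ∀ {e} → e ∈ cut G S
      → proj₁ e F.< proj₂ e × (proj₁ e ≡ x ⊎ proj₂ e ≡ x) × G (proj₁ e) (proj₂ e) ≡ true
    touches {u , v} e∈ with e∈pairs , crosses ← ∈-filterᵇ⁻ (pairs N) e∈ =
      ∈-pairs⁻ e∈pairs , ends , ∧-conicalˡ _ _ crosses
      where
      ends : u ≡ x ⊎ v ≡ x
      ends with u F.≟ x | v F.≟ x
      ... | yes u≡x | _ = inj₁ u≡x
      ... | no _ | yes v≡x = inj₂ v≡x
      ... | no u≢x | no v≢x = contradiction (begin
        true            ≡⟨ ∧-conicalʳ _ _ crosses ⟨
        S u xor S v     ≡⟨ cong (_xor S v) (constant u v u≢x v≢x) ⟩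
        S v xor S v     ≡⟨ xor-same (S v) ⟩
        false           ∎) λ ()
        where open ≡-Reasoning
    injective : ∀ {e e′} → e ∈ cut G S → e′ ∈ cut G S → other x e ≡ other x e′ → e ≡ e′
    injective e∈ e′∈ eq with lt , ends , _ ← touches e∈ | lt′ , ends′ , _ ← touches e′∈ =
      trans (sym (sortedPair-other lt ends)) (trans (cong (sortedPair x) eq) (sortedPair-other lt′ ends′))
    into : ∀ {e} → e ∈ cut G S → other x e ∈ neighbours G x
    into {u , v} e∈ with touches e∈
    ... | _ , inj₁ refl , Guv rewrite eqᵇ-refl u = ∈-filterᵇ⁺ (∈-allFin v) (trans (G-sym v u) Guv)
    ... | lt , inj₂ refl , Guv rewrite eqᵇ-≢ (Fin.<⇒≢ lt) = ∈-filterᵇ⁺ (∈-allFin u) Guv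

  module _ (G-irrefl : ∀ x → G x x ≡ false) (r : Fin N) (dominating : ∀ w → w ≢ r → G w r ≡ true) where

    -- A neighbour w of x gives the cut edge xw if it lies across the cut, and wr if it lies on the side of x.
    degree-≤-cutSize : ∀ S x → S x ≡ not (S r) → degree G x ≤ cutSize G S
    degree-≤-cutSize S x separated =
      length-≤-injection cutEdge (Unique-filterᵇ (Unique.allFin⁺ N)) injective into
      where
      x≢r : x ≢ r
      x≢r refl = not-¬ refl separated
      adjacent : ∀ {w} → w ∈ neighbours G x → G w x ≡ true
      adjacent = proj₂ ∘ ∈-filterᵇ⁻ (allFin N)
      neighbour-≢ : ∀ {w} → w ∈ neighbours G x → w ≢ x
      neighbour-≢ w∈ refl = contradiction (trans (sym (adjacent w∈)) (G-irrefl x)) λ ()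
      cutEdge : Fin N → Fin N × Fin N
      cutEdge w = if S w xor S x then sortedPair x w else sortedPair w r
      mixed : ∀ {a b} → b ∈ neighbours G x → sortedPair x a ≢ sortedPair b r
      mixed b∈ eq = [ (λ (x≡b , _) → neighbour-≢ b∈ (sym x≡b)) , (λ (x≡r , _) → x≢r x≡r) ]′ (sortedPair-≡ eq)
      injective : ∀ {a b} → a ∈ neighbours G x → b ∈ neighbours G x → cutEdge a ≡ cutEdge b → a ≡ b
      injective {a} {b} a∈ b∈ eq with S a xor S x | S b xor S x
      ... | true | true = sortedPair-injectiveʳ eq
      ... | false | false = sortedPair-injectiveˡ eq
      ... | true | false = contradiction eq (mixed b∈)
      ... | false | true = contradiction (sym eq) (mixed a∈)
      into : ∀ {w} → w ∈ neighbours G x → cutEdge w ∈ cut G S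
      into {w} w∈ with S w xor S x in across
      ... | true = sortedPair-∈-cut S (neighbour-≢ w∈ ∘ sym)
        (cong₂ _∧_ (trans (G-sym x w) (adjacent w∈)) (trans (xor-comm (S x) (S w)) across))
      ... | false = sortedPair-∈-cut S w≢r
        (cong₂ _∧_ (dominating w w≢r) (trans (cong (_xor S r) Sw≡not) (xor-inverseˡ (S r))))
        where
        Sw≡not : S w ≡ not (S r)
        Sw≡not = trans (xor≡false⇒≡ across) separated
        w≢r : w ≢ r
        w≢r refl = not-¬ refl Sw≡not

-- Spanning trees

module SpanningTree {N} {G T : Graph N} (tree : IsSpanningTree G T) (r : Fin N) where

  T-sym : ∀ x y → T x y ≡ T y x
  T-sym = proj₁ (proj₁ tree)

  T-acyclic : ∀ a b → T a b ≡ true → Connectedᵇ (removeEdge T a b) a b ≡ false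
  T-acyclic = proj₂ (proj₂ (proj₂ tree))

  open Walks T using (reach-last-step)

  shortest : ∀ z → ∃[ d ] reachᵇ T d r z ≡ true × (∀ {k} → reachᵇ T k r z ≡ true → d ≤ k)
  shortest z = minimal (λ k → reachᵇ T k r z) N (proj₁ (proj₂ (proj₂ tree)) r z)

  depth : Fin N → ℕ
  depth z = proj₁ (shortest z)

  depth-reaches : ∀ z → reachᵇ T (depth z) r z ≡ true
  depth-reaches z = proj₁ (proj₂ (shortest z))

  depth-minimal : ∀ {k z} → reachᵇ T k r z ≡ true → depth z ≤ k
  depth-minimal {z = z} = proj₂ (proj₂ (shortest z))

  last-edge : ∀ k {z} → z ≢ r → reachᵇ T k r z ≡ true → depth z ≡ k
    → ∃[ y ] T y z ≡ true × depth y < k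
  last-edge zero z≢r h _ = contradiction (sym (eqᵇ-sound h)) z≢r
  last-edge (suc k) z≢r h depth≡ with reach-last-step k h
  ... | inj₁ h′ = contradiction (subst (_≤ k) depth≡ (depth-minimal h′)) 1+n≰n
  ... | inj₂ (y , h′ , Tyz) = y , Tyz , s≤s (depth-minimal h′)

  parent : Fin N → Fin N
  parent z with z F.≟ r
  ... | yes _ = r
  ... | no z≢r = proj₁ (last-edge (depth z) z≢r (depth-reaches z) refl)

  parent-spec : ∀ {z} → z ≢ r → T (parent z) z ≡ true × depth (parent z) < depth z
  parent-spec {z} z≢r with z F.≟ r
  ... | yes z≡r = contradiction z≡r z≢r
  ... | no z≢r = proj₂ (last-edge (depth z) z≢r (depth-reaches z) refl)

  -- Following parents from parent x never visits x, since depths decrease.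
  root-connected-to-parent : ∀ {x} → x ≢ r → ∀ {a b} → a ≡ x ⊎ b ≡ x
    → Connectedᵇ (removeEdge T a b) r (parent x) ≡ true
  root-connected-to-parent {x} x≢r {a} {b} x∈ab = W.reach⇒connected (depth (parent x))
    (reach-shallower (depth (parent x)) (parent x) ≤-refl (proj₂ (parent-spec x≢r)))
    where
    module W = Walks (removeEdge T a b)
    shallower-≢ : ∀ {z} → depth z < depth x → z ≢ x
    shallower-≢ shallower refl = <-irrefl refl shallower
    reach-shallower : ∀ d z → depth z ≤ d → depth z < depth x
      → reachᵇ (removeEdge T a b) (depth z) r z ≡ true
    reach-shallower d z _ _ with z F.≟ r
    ... | yes refl = W.reach-refl (depth z) z
    reach-shallower zero z ≤0 _ | no z≢r = contradiction (≤-trans (proj₂ (parent-spec z≢r)) ≤0) λ ()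
    reach-shallower (suc d) z ≤d shallower | no z≢r =
      W.reach-mono closer (W.reach-step (depth (parent z)) (reach-shallower d (parent z) ≤d′ shallower′)
        (removeEdge-keeps T x∈ab (shallower-≢ shallower′) (shallower-≢ shallower) (proj₁ (parent-spec z≢r))))
      where
      closer = proj₂ (parent-spec z≢r)
      ≤d′ = ≤-pred (≤-trans closer ≤d)
      shallower′ = <-trans closer shallower

  parent-edge-separates : ∀ {x} → x ≢ r → ∀ {a b} → (a , b) ≡ (x , parent x) ⊎ (a , b) ≡ (parent x , x)
    → side T a b x ≡ not (side T a b r)
  parent-edge-separates {x} x≢r (inj₁ refl) =
    trans (W.connected-refl x) (cong not (sym (trans (W.connected-respects T′-sym root) cycle-free)))
    where
    module W = Walks (removeEdge T x (parent x))
    T′-sym = removeEdge-sym T-sym x (parent x)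
    root = root-connected-to-parent x≢r (inj₁ refl)
    cycle-free = T-acyclic x (parent x) (trans (T-sym x (parent x)) (proj₁ (parent-spec x≢r)))
  parent-edge-separates {x} x≢r (inj₂ refl) =
    trans (T-acyclic (parent x) x (proj₁ (parent-spec x≢r))) (cong not (sym (W.connected-sym T′-sym root)))
    where
    module W = Walks (removeEdge T (parent x) x)
    T′-sym = removeEdge-sym T-sym (parent x) x
    root = root-connected-to-parent x≢r (inj₂ refl)

module _ {N} (r : Fin N) where

  radial-sym : ∀ x y → radial r x y ≡ radial r y x
  radial-sym x y = ∨-comm (eqᵇ x r ∧ not (eqᵇ y r)) _

  radial-irrefl : ∀ x → radial r x x ≡ false
  radial-irrefl x with eqᵇ x r
  ... | true = refl
  ... | false = refl

  radial-to-root : ∀ {x} → x ≢ r → radial r x r ≡ true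
  radial-to-root x≢r rewrite eqᵇ-≢ x≢r | eqᵇ-refl r = refl

  radial-away : ∀ {u v} → u ≢ r → v ≢ r → radial r u v ≡ false
  radial-away u≢r v≢r rewrite eqᵇ-≢ u≢r | eqᵇ-≢ v≢r = refl

  radial-edge⁻ : ∀ {u v} → radial r u v ≡ true → (u ≡ r × v ≢ r) ⊎ (v ≡ r × u ≢ r)
  radial-edge⁻ {u} {v} h with u F.≟ r | v F.≟ r
  ... | yes u≡r | no v≢r = inj₁ (u≡r , v≢r)
  ... | no u≢r | yes v≡r = inj₂ (v≡r , u≢r)
  ... | yes _ | yes _ = contradiction h λ ()
  ... | no _ | no _ = contradiction h λ ()

  radial-isolates : ∀ {x} → x ≢ r → ∀ {a b} → (a , b) ≡ (x , r) ⊎ (a , b) ≡ (r , x)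
    → ∀ z → removeEdge (radial r) a b z x ≡ false
  radial-isolates {x} x≢r ends z with toSum (z F.≟ r) | ends
  ... | inj₁ refl | inj₁ refl = removeEdge-removes-reversed (radial z) x z
  ... | inj₁ refl | inj₂ refl = removeEdge-removes (radial z) z x
  ... | inj₂ z≢r | _ rewrite radial-away z≢r x≢r = refl

others : ∀ {N} → Fin N → List (Fin N)
others {N} r = filterᵇ (λ x → not (eqᵇ x r)) (allFin N)

∈-others⁺ : ∀ {N} {r x : Fin N} → x ≢ r → x ∈ others r
∈-others⁺ {x = x} x≢r = ∈-filterᵇ⁺ (∈-allFin x) (cong not (eqᵇ-≢ x≢r))

∈-others⁻ : ∀ {N} {r x : Fin N} → x ∈ others r → x ≢ r
∈-others⁻ {N} {r} x∈ refl =
  contradiction (trans (sym (proj₂ (∈-filterᵇ⁻ (allFin N) x∈))) (cong not (eqᵇ-refl r))) λ ()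

degreeSum : ∀ {N} → Graph N → Fin N → ℕ → ℕ
degreeSum G r p = sum (map (λ x → degree G x ^ p) (others r))

module DominatingVertex {N} {G : Graph N} (G-sym : ∀ x y → G x y ≡ G y x) (G-irrefl : ∀ x → G x x ≡ false)
                 (r : Fin N) (dominating : ∀ w → w ≢ r → G w r ≡ true) where

  open Cuts G-sym

  degreeSum-≤-congestionPow : ∀ {T} → IsSpanningTree G T → ∀ p → degreeSum G r p ≤ congestionPow G T p
  degreeSum-≤-congestionPow {T} tree p =
    sum-≤-injection parentEdge (λ x → degree G x ^ p) (λ e → congestion G T (proj₁ e) (proj₂ e) ^ p)
      (Unique-filterᵇ (Unique.allFin⁺ N)) injective into bound
    where
    open SpanningTree tree r
    parentEdge : Fin N → Fin N × Fin N
    parentEdge x = sortedPair x (parent x)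
    closer : ∀ {x} → x ∈ others r → depth (parent x) < depth x
    closer = proj₂ ∘ parent-spec ∘ ∈-others⁻
    injective : ∀ {x y} → x ∈ others r → y ∈ others r → parentEdge x ≡ parentEdge y → x ≡ y
    injective {x} {y} x∈ y∈ eq with sortedPair-≡ eq
    ... | inj₁ (x≡y , _) = x≡y
    ... | inj₂ (x≡py , px≡y) = contradiction
      (subst (λ z → depth z < depth x) px≡y (closer x∈))
      (<-asym (subst (λ z → depth z < depth y) (sym x≡py) (closer y∈)))
    into : ∀ {x} → x ∈ others r → parentEdge x ∈ edges T
    into {x} x∈ =
      sortedPair-∈-edges T-sym x≢parent (trans (T-sym x (parent x)) (proj₁ (parent-spec (∈-others⁻ x∈))))
      where
      x≢parent : x ≢ parent x
      x≢parent x≡ = <-irrefl (cong depth (sym x≡)) (closer x∈)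
    bound : ∀ {x} → x ∈ others r
      → degree G x ^ p ≤ congestion G T (proj₁ (parentEdge x)) (proj₂ (parentEdge x)) ^ p
    bound {x} x∈ = ^-monoˡ-≤ p (degree-≤-cutSize G-irrefl r dominating (side T a b) x
      (parent-edge-separates (∈-others⁻ x∈) (sortedPair-cases x (parent x))))
      where
      a = proj₁ (parentEdge x)
      b = proj₂ (parentEdge x)

  radial-spanning : IsSpanningTree G (radial r)
  radial-spanning = (radial-sym r , radial-irrefl r) , subgraph , connected , acyclic
    where
    open Walks (radial r) using (connected-refl; connected-edge; connected-trans; connected-sym)
    subgraph : ∀ x y → radial r x y ≡ true → G x y ≡ true
    subgraph x y h with radial-edge⁻ r {x} {y} h
    ... | inj₁ (refl , y≢r) = trans (G-sym x y) (dominating y y≢r)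
    ... | inj₂ (refl , x≢r) = dominating x x≢r
    connected-to-root : ∀ x → Connectedᵇ (radial r) x r ≡ true
    connected-to-root x with toSum (x F.≟ r)
    ... | inj₁ refl = connected-refl x
    ... | inj₂ x≢r = connected-edge (radial-to-root r x≢r)
    connected : ∀ x y → Connectedᵇ (radial r) x y ≡ true
    connected x y = connected-trans (connected-to-root x) (connected-sym (radial-sym r) (connected-to-root y))
    acyclic : ∀ a b → radial r a b ≡ true → Connectedᵇ (removeEdge (radial r) a b) a b ≡ false
    acyclic a b h with radial-edge⁻ r {a} {b} h
    ... | inj₁ (refl , b≢r) = ¬-not λ c → b≢r (sym (W.reach-isolated (radial-isolates r b≢r (inj₂ refl)) N c))
      where module W = Walks (removeEdge (radial r) a b)
    ... | inj₂ (refl , a≢r) = ¬-not λ c → a≢r (sym (W.reach-isolated (radial-isolates r a≢r (inj₁ refl)) N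
                                                   (W.connected-sym (removeEdge-sym (radial-sym r) a b) c)))
      where module W = Walks (removeEdge (radial r) a b)

  -- Every vertex other than x stays joined to r, so the spoke xr cuts off {x} alone.
  radial-congestion : ∀ {x} → x ≢ r → ∀ {a b} → (a , b) ≡ (x , r) ⊎ (a , b) ≡ (r , x)
    → congestion G (radial r) a b ≤ degree G x
  radial-congestion {x} x≢r {a} {b} ends = cutSize-≤-degree (side (radial r) a b) x constant
    where
    module W = Walks (removeEdge (radial r) a b)
    T′-sym = removeEdge-sym (radial-sym r) a b
    x∈ab : a ≡ x ⊎ b ≡ x
    x∈ab = Sum.map (proj₁ ∘ ,-injective) (proj₂ ∘ ,-injective) ends
    root-connected : ∀ {u} → u ≢ x → Connectedᵇ (removeEdge (radial r) a b) r u ≡ true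
    root-connected {u} u≢x with toSum (u F.≟ r)
    ... | inj₁ refl = W.connected-refl u
    ... | inj₂ u≢r = W.connected-edge
      (removeEdge-keeps (radial r) x∈ab (x≢r ∘ sym) u≢x (trans (radial-sym r r u) (radial-to-root r u≢r)))
    constant : ∀ u v → u ≢ x → v ≢ x → side (radial r) a b u ≡ side (radial r) a b v
    constant u v u≢x v≢x = trans (sym (W.connected-respects T′-sym (root-connected u≢x)))
                                 (W.connected-respects T′-sym (root-connected v≢x))

  radial-congestionPow : ∀ p → congestionPow G (radial r) p ≡ degreeSum G r p
  radial-congestionPow p = ≤-antisym
    (sum-≤-injection (other r) (λ e → congestion G (radial r) (proj₁ e) (proj₂ e) ^ p) (λ x → degree G x ^ p)
      (Unique-filterᵇ (Unique-pairs N)) injective into bound)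
    (degreeSum-≤-congestionPow radial-spanning p)
    where
    spoke : ∀ {e} → e ∈ edges (radial r)
      → proj₁ e F.< proj₂ e × (proj₁ e ≡ r × proj₂ e ≢ r ⊎ proj₂ e ≡ r × proj₁ e ≢ r)
    spoke {u , v} e∈ = Product.map₂ (radial-edge⁻ r {u} {v}) (∈-edges⁻ e∈)
    injective : ∀ {e e′} → e ∈ edges (radial r) → e′ ∈ edges (radial r) → other r e ≡ other r e′ → e ≡ e′
    injective e∈ e′∈ eq with lt , ends ← spoke e∈ | lt′ , ends′ ← spoke e′∈ =
      trans (sym (sortedPair-other lt (Sum.map proj₁ proj₁ ends)))
        (trans (cong (sortedPair r) eq) (sortedPair-other lt′ (Sum.map proj₁ proj₁ ends′)))
    into : ∀ {e} → e ∈ edges (radial r) → other r e ∈ others r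
    into {u , v} e∈ with spoke e∈
    ... | _ , inj₁ (refl , v≢r) rewrite eqᵇ-refl u = ∈-others⁺ v≢r
    ... | _ , inj₂ (refl , u≢r) rewrite eqᵇ-≢ u≢r = ∈-others⁺ u≢r
    bound : ∀ {e} → e ∈ edges (radial r)
      → congestion G (radial r) (proj₁ e) (proj₂ e) ^ p ≤ degree G (other r e) ^ p
    bound {u , v} e∈ with spoke e∈
    ... | _ , inj₁ (refl , v≢r) rewrite eqᵇ-refl u = ^-monoˡ-≤ p (radial-congestion v≢r (inj₂ refl))
    ... | _ , inj₂ (refl , u≢r) rewrite eqᵇ-≢ u≢r = ^-monoˡ-≤ p (radial-congestion u≢r (inj₁ refl))

-- Complete multipartite graphs

module Multipartite {N K} (part : Fin N → Fin K) where

  multipartite-sym : ∀ x y → multipartite part x y ≡ multipartite part y x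
  multipartite-sym x y = cong not (eqᵇ-sym (part x) (part y))

  multipartite-irrefl : ∀ x → multipartite part x x ≡ false
  multipartite-irrefl x = cong not (eqᵇ-refl (part x))

  degree-multipartite : ∀ x → degree (multipartite part) x ≡ N ∸ partSize part (part x)
  degree-multipartite x = begin
    degree (multipartite part) x                              ≡⟨ m+n∸m≡n (size x) _ ⟨
    size x + degree (multipartite part) x ∸ size x            ≡⟨ cong (_∸ size x) complement ⟩
    length (allFin N) ∸ size x                                ≡⟨ cong (_∸ size x) (length-tabulate id) ⟩
    N ∸ size x                                                ∎
    where
    open ≡-Reasoning
    size = partSize part ∘ part
    complement = length-filterᵇ-complement (λ w → eqᵇ (part w) (part x)) (allFin N)

  alone-in-part : ∀ {r} → partSize part (part r) ≡ 1 → ∀ u → part u ≡ part r → u ≡ r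
  alone-in-part {r} size≡1 u same with toSum (u F.≟ r)
  ... | inj₁ u≡r = u≡r
  ... | inj₂ u≢r =
    contradiction (subst (2 ≤_) size≡1 (length-≤-injection id unique (λ _ _ → id) into)) λ { (s≤s ()) }
    where
    unique : Unique (u ∷ r ∷ [])
    unique = (u≢r All.∷ All.[]) ∷ (All.[] ∷ AllPairs.[])
    into : ∀ {w} → w ∈ u ∷ r ∷ [] → w ∈ filterᵇ (λ x → eqᵇ (part x) (part r)) (allFin N)
    into (here refl) = ∈-filterᵇ⁺ (∈-allFin u) (subst (λ i → eqᵇ (part u) i ≡ true) same (eqᵇ-refl (part u)))
    into (there (here refl)) = ∈-filterᵇ⁺ (∈-allFin r) (eqᵇ-refl (part r))

sum-by-part : ∀ {N K} (part : Fin N → Fin K) (h : Fin K → ℕ)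
  → sum (map (h ∘ part) (allFin N)) ≡ sum (map (λ i → partSize part i * h i) (allFin K))
sum-by-part {N} {K} part h = begin
  sum (map (h ∘ part) (allFin N))
    ≡⟨ cong sum (map-cong (λ x → sum-indicator (part x) h (Unique.allFin⁺ K) (∈-allFin (part x))) (allFin N)) ⟨
  sum (map (λ x → sum (map (indicator x) (allFin K))) (allFin N))
    ≡⟨ sum-map-swap indicator (allFin N) (allFin K) ⟩
  sum (map (λ i → sum (map (λ x → indicator x i) (allFin N))) (allFin K))
    ≡⟨ cong sum (map-cong count (allFin K)) ⟨
  sum (map (λ i → partSize part i * h i) (allFin K)) ∎
  where
  open ≡-Reasoning
  indicator : Fin N → Fin K → ℕ
  indicator x i = if eqᵇ (part x) i then h i else 0
  count : ∀ i → partSize part i * h i ≡ sum (map (λ x → indicator x i) (allFin N))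
  count i = trans (sym (sum-map-const (h i) (filterᵇ (λ x → eqᵇ (part x) i) (allFin N))))
                  (sum-map-filterᵇ (λ x → eqᵇ (part x) i) (λ _ → h i) (allFin N))

degreeSum-multipartite : ∀ {N m} (n : Fin (suc m) → ℕ) (part : Fin N → Fin (suc m))
  → (∀ i → partSize part i ≡ n i) → ∀ {r} → part r ≡ fromℕ m → (∀ u → part u ≡ part r → u ≡ r)
  → ∀ p → degreeSum (multipartite part) r p
          ≡ sum (map (λ i → n (inject₁ i) * (N ∸ n (inject₁ i)) ^ p) (allFin m))
degreeSum-multipartite {N} {m} n part part-size {r} r-last alone p = begin
  degreeSum (multipartite part) r p
    ≡⟨ sum-map-filterᵇ (λ x → not (eqᵇ x r)) (λ x → degree (multipartite part) x ^ p) (allFin N) ⟩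
  sum (map (λ x → if not (eqᵇ x r) then degree (multipartite part) x ^ p else 0) (allFin N))
    ≡⟨ cong sum (map-cong by-part (allFin N)) ⟩
  sum (map (weight ∘ part) (allFin N))
    ≡⟨ sum-by-part part weight ⟩
  sum (map (λ i → partSize part i * weight i) (allFin (suc m)))
    ≡⟨ cong sum (map-cong (λ i → cong (_* weight i) (part-size i)) (allFin (suc m))) ⟩
  sum (map (λ i → n i * weight i) (allFin (suc m)))
    ≡⟨ sum-allFin-last m (λ i → n i * weight i) ⟩
  sum (map (λ i → n (inject₁ i) * weight (inject₁ i)) (allFin m)) + n (fromℕ m) * weight (fromℕ m)
    ≡⟨ cong₂ _+_ (cong sum (map-cong (λ i → cong (n (inject₁ i) *_) (weight-inject₁ i)) (allFin m)))
                 (trans (cong (n (fromℕ m) *_) weight-last) (*-zeroʳ (n (fromℕ m)))) ⟩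
  sum (map (λ i → n (inject₁ i) * (N ∸ n (inject₁ i)) ^ p) (allFin m)) + 0
    ≡⟨ +-identityʳ _ ⟩
  sum (map (λ i → n (inject₁ i) * (N ∸ n (inject₁ i)) ^ p) (allFin m)) ∎
  where
  open ≡-Reasoning
  open Multipartite part using (degree-multipartite)
  -- r is the only vertex of the last part, so summing over x ≠ r means giving the last part weight 0.
  weight : Fin (suc m) → ℕ
  weight i = if eqᵇ i (fromℕ m) then 0 else (N ∸ n i) ^ p
  weight-last : weight (fromℕ m) ≡ 0
  weight-last rewrite eqᵇ-refl (fromℕ m) = refl
  weight-inject₁ : ∀ i → weight (inject₁ i) ≡ (N ∸ n (inject₁ i)) ^ p
  weight-inject₁ i rewrite eqᵇ-≢ (Fin.fromℕ≢inject₁ {i = i} ∘ sym) = refl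
  by-part : ∀ x → (if not (eqᵇ x r) then degree (multipartite part) x ^ p else 0) ≡ weight (part x)
  by-part x with toSum (x F.≟ r)
  ... | inj₁ refl rewrite eqᵇ-refl x | r-last | eqᵇ-refl (fromℕ m) = refl
  ... | inj₂ x≢r rewrite eqᵇ-≢ x≢r | eqᵇ-≢ (x≢r ∘ alone x ∘ (λ same → trans same (sym r-last))) =
    cong (_^ p) (trans (degree-multipartite x) (cong (N ∸_) (part-size (part x))))

mainTheorem10 : (m : ℕ) → 1 ≤ m → (n : Fin (suc m) → ℕ)
    → (∀ i j → i F.≤ j → n j ≤ n i) → n (fromℕ m) ≡ 1
    → (part : Fin (sum (map n (allFin (suc m)))) → Fin (suc m))
    → (∀ i → partSize part i ≡ n i)
    → (r : Fin (sum (map n (allFin (suc m))))) → part r ≡ fromℕ m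
    → (p : ℕ) → 1 ≤ p
    → IsSpanningTree (multipartite part) (radial r)
      × congestionPow (multipartite part) (radial r) p
          ≡ sum (map (λ i → n (inject₁ i) * (sum (map n (allFin (suc m))) ∸ n (inject₁ i)) ^ p) (allFin m))
      × (∀ T → IsSpanningTree (multipartite part) T
           → congestionPow (multipartite part) (radial r) p ≤ congestionPow (multipartite part) T p)
mainTheorem10 m _ n _ n-last part part-size r r-last p _ =
  radial-spanning ,
  trans (radial-congestionPow p) (degreeSum-multipartite n part part-size r-last alone p) ,
  λ T tree → ≤-trans (≤-reflexive (radial-congestionPow p)) (degreeSum-≤-congestionPow tree p)
  where
  open Multipartite part
  alone : ∀ u → part u ≡ part r → u ≡ r
  alone = alone-in-part (trans (part-size (part r)) (trans (cong n r-last) n-last))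
  open DominatingVertex multipartite-sym multipartite-irrefl r (λ w w≢r → cong not (eqᵇ-≢ (w≢r ∘ alone w)))
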